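{- Let $G$ be a finite simple graph with a dominating set $S$, and let $S'\subseteq S$ be such that every vertex of $V(G)-S$ has a neighbor in $S'$. Then $\pi^{c}(G)\le |S|+|S'|$. In particular, $\pi^{c}(G)\le 2\gamma(G)$.
   Context: $\gamma(G)$ is the domination number of $G$. A configuration of cops on $G$ is a function $C:V(G)\to\mathbb{Z}_{\ge 0}$ of size $\sum_v C(v)$. A pebbling step from a vertex $u$ with at least two cops to an adjacent vertex $v$ removes two cops from $u$ and adds one cop to $v$. In the cops and robbers pebbling game, cops are placed according to $C$, then a robber chooses a starting vertex; thereafter, in each turn the cops make pebbling steps, after which the robber either moves to an adjacent vertex or stays put. The robber is captured when he occupies a vertex holding at least one cop. The cop pebbling number $\pi^{c}(G)$ is the minimum $m$ such that some configuration of size $m$ allows the cops to capture the robber regardless of how he starts and moves. -}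

module Defs where

open import Data.Nat using (ℕ; suc; _∸_; _+_; _*_; _≤_)
open import Data.Fin using (Fin; _≟_)
open import Data.Fin.Subset using (Subset; _∈_; _∉_; _⊆_; ∣_∣)
open import Data.Vec using (sum; tabulate)
open import Data.Bool using (if_then_else_)
open import Data.Product using (Σ; ∃; _×_)
open import Data.Sum using (_⊎_)
open import Relation.Nullary using (¬_)
open import Relation.Nullary.Decidable using (⌊_⌋)
open import Relation.Binary.PropositionalEquality using (_≡_)
open import Relation.Binary.Construct.Closure.ReflexiveTransitive using (Star)

record Graph (n : ℕ) : Set₁ where
  field
    Adj    : Fin n → Fin n → Set
    sym    : ∀ {u v} → Adj u v → Adj v u
    irrefl : ∀ {u} → ¬ Adj u u
open Graph public

Config : ℕ → Set
Config n = Fin n → ℕ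

size : ∀ {n} → Config n → ℕ
size C = sum (tabulate C)

pebble : ∀ {n} → Config n → Fin n → Fin n → Config n
pebble C u v w =
  if ⌊ w ≟ u ⌋ then C w ∸ 2 else (if ⌊ w ≟ v ⌋ then suc (C w) else C w)

data Step {n} (G : Graph n) : Config n → Config n → Set where
  step : ∀ {C} (u v : Fin n) → Adj G u v → 2 ≤ C u → Step G C (pebble C u v)

-- A (possibly empty) finite sequence of pebbling steps: one cops' turn.
Steps : ∀ {n} → Graph n → Config n → Config n → Set
Steps G = Star (Step G)

RobberMove : ∀ {n} → Graph n → Fin n → Fin n → Set
RobberMove G r r' = r' ≡ r ⊎ Adj G r r'

-- CopWin G C r: it is the cops' turn, cops are at C, robber at r, and the
-- cops can force capture in finitely many turns (inductive = finite play).
data CopWin {n} (G : Graph n) : Config n → Fin n → Set where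
  play : ∀ {C r} (C' : Config n) → Steps G C C' →
         (1 ≤ C' r ⊎ (∀ r' → RobberMove G r r' → CopWin G C' r')) →
         CopWin G C r

Winning : ∀ {n} → Graph n → Config n → Set
Winning G C = ∀ r → CopWin G C r

-- π^c(G) ≤ m  iff some winning configuration has size at most m.
CopPebblingAtMost : ∀ {n} → Graph n → ℕ → Set
CopPebblingAtMost G m = Σ (Config _) λ C → size C ≤ m × Winning G C

Dominating : ∀ {n} → Graph n → Subset n → Set
Dominating G S = ∀ v → v ∈ S ⊎ ∃ λ u → u ∈ S × Adj G u v

IsDominationNumber : ∀ {n} → Graph n → ℕ → Set
IsDominationNumber G k =
  (∃ λ S → Dominating G S × ∣ S ∣ ≡ k) × (∀ S → Dominating G S → k ≤ ∣ S ∣)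

{-# OPTIONS --safe #-}
module Submission where

-- Place one cop on every vertex of S and a second one on every vertex of S'.
-- A robber starting in S is caught at once; a robber starting outside S is
-- adjacent to some u ∈ S', whose two cops pebble one cop onto him before he
-- can move.  Taking S' = S for a minimum dominating set S gives 2γ(G).

open import Defs
open import Algebra.Properties.CommutativeSemigroup using (interchange)
open import Data.Nat using (ℕ; zero; suc; _+_; _*_; _≤_; z≤n; s≤s)
open import Data.Nat.Properties using (+-commutativeSemigroup; +-identityʳ; ≤-reflexive)
open import Data.Fin as Fin using (_≟_)
open import Data.Fin.Patterns using (0F)
open import Data.Fin.Subset using (Subset; Side; inside; outside; _∈_; _∉_; _⊆_; ∣_∣)
open import Data.Fin.Subset.Properties using (_∈?_; ⊆-refl)
open import Data.Product using (∃; _×_; _,_)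
open import Data.Sum using (_⊎_; inj₁; inj₂)
open import Data.Vec using ([]; _∷_; lookup)
open import Data.Vec.Properties using ([]=⇒lookup)
open import Function using (_∘_)
open import Relation.Nullary using (yes; no; contradiction)
open import Relation.Binary.PropositionalEquality
  using (_≡_; _≢_; refl; cong; cong₂; subst; trans) renaming (sym to ≡-sym)
open import Relation.Binary.Construct.Closure.ReflexiveTransitive using (ε; _◅_)

_⊕_ : ∀ {n} → Config n → Config n → Config n
(C ⊕ D) v = C v + D v

size-⊕ : ∀ {n} (C D : Config n) → size (C ⊕ D) ≡ size C + size D
size-⊕ {zero}  C D = refl
size-⊕ {suc n} C D =
  trans (cong (C 0F + D 0F +_) (size-⊕ (C ∘ Fin.suc) (D ∘ Fin.suc)))
        (interchange +-commutativeSemigroup (C 0F) (D 0F) _ _)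

sideCount : Side → ℕ
sideCount inside  = 1
sideCount outside = 0

indicator : ∀ {n} → Subset n → Config n
indicator p v = sideCount (lookup p v)

size-indicator : ∀ {n} (p : Subset n) → size (indicator p) ≡ ∣ p ∣
size-indicator []            = refl
size-indicator (inside ∷ p)  = cong suc (size-indicator p)
size-indicator (outside ∷ p) = size-indicator p

indicator-∈ : ∀ {n} {p : Subset n} {v} → v ∈ p → indicator p v ≡ 1
indicator-∈ v∈p = cong sideCount ([]=⇒lookup v∈p)

pebble-target : ∀ {n} (C : Config n) {u v} → v ≢ u → pebble C u v v ≡ suc (C v)
pebble-target C {u} {v} v≢u with v ≟ u | v ≟ v
... | yes v≡u | _      = contradiction v≡u v≢u
... | no _    | yes _  = refl
... | no _    | no v≢v = contradiction refl v≢v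

Guarded : ∀ {n} → Graph n → Config n → Set
Guarded G C = ∀ r → 1 ≤ C r ⊎ ∃ λ u → Adj G u r × 2 ≤ C u

guarded⇒winning : ∀ {n} (G : Graph n) {C : Config n} → Guarded G C → Winning G C
guarded⇒winning G {C} guarded r with guarded r
... | inj₁ occupied            = play C ε (inj₁ occupied)
... | inj₂ (u , u~r , 2≤C[u]) =
  play (pebble C u r) (step u r u~r 2≤C[u] ◅ ε)
       (inj₁ (subst (1 ≤_) (≡-sym (pebble-target C r≢u)) (s≤s z≤n)))
  where
  r≢u : r ≢ u
  r≢u refl = irrefl G u~r

indicator-⊕-guarded : ∀ {n} (G : Graph n) (S S' : Subset n) → S' ⊆ S →
  (∀ v → v ∉ S → ∃ λ u → u ∈ S' × Adj G v u) →
  Guarded G (indicator S ⊕ indicator S')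
indicator-⊕-guarded G S S' S'⊆S near r with r ∈? S
... | yes r∈S = inj₁ (subst (λ k → 1 ≤ k + indicator S' r) (≡-sym (indicator-∈ r∈S)) (s≤s z≤n))
... | no  r∉S with near r r∉S
...   | u , u∈S' , r~u =
  inj₂ (u , sym G r~u , ≤-reflexive (≡-sym (cong₂ _+_ (indicator-∈ (S'⊆S u∈S')) (indicator-∈ u∈S'))))

cop-pebbling-≤-∣S∣+∣S'∣ : ∀ {n} (G : Graph n) (S S' : Subset n) → S' ⊆ S →
  (∀ v → v ∉ S → ∃ λ u → u ∈ S' × Adj G v u) →
  CopPebblingAtMost G (∣ S ∣ + ∣ S' ∣)
cop-pebbling-≤-∣S∣+∣S'∣ G S S' S'⊆S near =
  indicator S ⊕ indicator S' ,
  ≤-reflexive (trans (size-⊕ (indicator S) (indicator S'))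
                     (cong₂ _+_ (size-indicator S) (size-indicator S'))) ,
  guarded⇒winning G (indicator-⊕-guarded G S S' S'⊆S near)

dominating⇒outside-has-neighbour : ∀ {n} (G : Graph n) {S : Subset n} → Dominating G S →
  ∀ v → v ∉ S → ∃ λ u → u ∈ S × Adj G v u
dominating⇒outside-has-neighbour G dom v v∉S with dom v
... | inj₁ v∈S             = contradiction v∈S v∉S
... | inj₂ (u , u∈S , u~v) = u , u∈S , sym G u~v

theorem4 : ∀ {n} (G : Graph n) →
    ((S S' : Subset n) → Dominating G S → S' ⊆ S →
      (∀ v → v ∉ S → ∃ λ u → u ∈ S' × Adj G v u) →
      CopPebblingAtMost G (∣ S ∣ + ∣ S' ∣))
    × ((k : ℕ) → IsDominationNumber G k → CopPebblingAtMost G (2 * k))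
theorem4 G = (λ S S' _ → cop-pebbling-≤-∣S∣+∣S'∣ G S S') , cop-pebbling-≤-2γ
  where
  cop-pebbling-≤-2γ : (k : ℕ) → IsDominationNumber G k → CopPebblingAtMost G (2 * k)
  cop-pebbling-≤-2γ k ((S , dom , refl) , _)
    rewrite +-identityʳ ∣ S ∣ =
    cop-pebbling-≤-∣S∣+∣S'∣ G S S ⊆-refl (dominating⇒outside-has-neighbour G dom)
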